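{- Let $\mathcal A_1,\mathcal A_2\subseteq\mathbb N$ be such that for every $m\in\mathcal A_1$ there exists $n\in\mathcal A_2$ with $m\le n$. Then for every environment $L$ and term $T$, if $L\vdash_{\mathcal A_1}T$ then $L\vdash_{\mathcal A_2}T$.
   Context: Fix a nonempty set $\Sigma$ of sorts with decidable equality, an arbitrary function $\mathrm{next}:\Sigma\to\Sigma$, and a countably infinite set of variables. Terms and environments: $T,U,V,W ::= \star s \mid x \mid \mathrm{app}(V,T) \mid \lambda x{:}W.\,T \mid \mathrm{def}(x{=}V).\,T \mid \mathrm{cast}(U,T)$ ($s\in\Sigma$) and $L,K ::= \emptyset \mid K,x{:}W \mid K,x{=}V$. $\mathrm{app}(V,T)$ applies $T$ to $V$; $\lambda x{:}W.\,T$ (de Bruijn's abstraction) and $\mathrm{def}(x{=}V).\,T$ (local definition) bind $x$ in $T$; $\mathrm{cast}(U,T)$ annotates $T$ with expected type $U$; entries $x{:}W$ and $x{=}V$ bind $x$. Terms are modulo renaming of bound variables. Write $\mathsf{B}x[V]$ for either $\lambda x{:}V$ or $\mathrm{def}(x{=}V)$ and correspondingly $L,x[V]$ for $L,x{:}V$ resp. $L,x{=}V$. One step of bound rt-reduction $L\vdash T_1\to^nT_2$ is the smallest relation closed under: $L\vdash\mathrm{app}(V,\lambda x{:}W.\,T)\to^0\mathrm{def}(x{=}\mathrm{cast}(W,V)).\,T$; $K,x{=}V\vdash x\to^0V$; $L\vdash\mathrm{def}(x{=}V).\,T\to^0T$ if $x$ not free in $T$; $L\vdash\mathrm{app}(V,\mathrm{def}(x{=}W).\,T)\to^0\mathrm{def}(x{=}W).\,\mathrm{app}(V,T)$;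 $L\vdash\mathrm{cast}(U,T)\to^0T$; $L\vdash\star s\to^1\star\,\mathrm{next}(s)$; $K,x{:}W\vdash x\to^1W$; $L\vdash\mathrm{cast}(U,T)\to^1U$; if $K\vdash x\to^nT$, $y\neq x$, $y$ not free in $T$ then $K,y[V]\vdash x\to^nT$; if $L\vdash V_1\to^0V_2$ then $L\vdash\mathrm{app}(V_1,T)\to^0\mathrm{app}(V_2,T)$; if $L\vdash T_1\to^nT_2$ then $L\vdash\mathrm{app}(V,T_1)\to^n\mathrm{app}(V,T_2)$; if $L\vdash V_1\to^0V_2$ then $L\vdash\mathsf Bx[V_1].\,T\to^0\mathsf Bx[V_2].\,T$; if $L,x[V]\vdash T_1\to^nT_2$ then $L\vdash\mathsf Bx[V].\,T_1\to^n\mathsf Bx[V].\,T_2$; if $L\vdash U_1\to^0U_2$ then $L\vdash\mathrm{cast}(U_1,T)\to^0\mathrm{cast}(U_2,T)$; if $L\vdash T_1\to^0T_2$ then $L\vdash\mathrm{cast}(U,T_1)\to^0\mathrm{cast}(U,T_2)$; if $L\vdash U_1\to^1U_2$ and $L\vdash T_1\to^1T_2$ then $L\vdash\mathrm{cast}(U_1,T_1)\to^1\mathrm{cast}(U_2,T_2)$. $L\vdash T_1\to^{*n}T_2$ is the smallest relation with $L\vdash T\to^{*0}T$, containing single steps, and with $L\vdash T_1\to^{*n_1}T$, $L\vdash T\to^{*n_2}T_2$ implying $L\vdash T_1\to^{*n_1+n_2}T_2$. For $\mathcal A\subseteq\mathbb N$, validity $L\vdash_{\mathcal A}T$ is the smallest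 predicate closed under: $L\vdash_{\mathcal A}\star s$; if $K\vdash_{\mathcal A}V$ then $K,x[V]\vdash_{\mathcal A}x$; if $K\vdash_{\mathcal A}x$ and $y\neq x$ then $K,y[V]\vdash_{\mathcal A}x$; if $L\vdash_{\mathcal A}V$ and $L,x[V]\vdash_{\mathcal A}T$ then $L\vdash_{\mathcal A}\mathsf Bx[V].\,T$; if $L\vdash_{\mathcal A}U$, $L\vdash_{\mathcal A}T$ and some $U_0$ satisfies $L\vdash T\to^{*1}U_0$, $L\vdash U\to^{*0}U_0$, then $L\vdash_{\mathcal A}\mathrm{cast}(U,T)$; if $L\vdash_{\mathcal A}V$, $L\vdash_{\mathcal A}T$ and there are $n\in\mathcal A$, $x,W_0,U_0$ with $L\vdash T\to^{*n}\lambda x{:}W_0.\,U_0$ and $L\vdash V\to^{*1}W_0$, then $L\vdash_{\mathcal A}\mathrm{app}(V,T)$. -}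

module Defs where

open import Data.Nat using (ℕ; zero; suc; _+_; _<ᵇ_)
open import Data.Bool using (if_then_else_)
open import Data.Product using (∃; ∃-syntax; _×_; _,_)

-- Terms are represented with de Bruijn indices (terms modulo renaming of
-- bound variables).  The sort type S is a parameter.

-- kind of binder:  B x[V]  is either  λ x:V  (abst)  or  def(x=V)  (abbr)
data BKind : Set where
  abst abbr : BKind

data Term (S : Set) : Set where
  sort : S → Term S
  var  : ℕ → Term S
  app  : Term S → Term S → Term S        -- app V T  (applies T to V)
  bind : BKind → Term S → Term S → Term S
  cast : Term S → Term S → Term S

data Env (S : Set) : Set where
  ∅    : Env S
  _,_[_] : Env S → BKind → Term S → Env S

lift : {S : Set} → ℕ → Term S → Term S
lift d (sort s)     = sort s
lift d (var i)      = if i <ᵇ d then var i else var (suc i)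
lift d (app V T)    = app (lift d V) (lift d T)
lift d (bind b V T) = bind b (lift d V) (lift (suc d) T)
lift d (cast U T)   = cast (lift d U) (lift d T)

↑ : {S : Set} → Term S → Term S
↑ = lift 0

module _ {S : Set} (next : S → S) where

  data _⊢_⟶[_]_ : Env S → Term S → ℕ → Term S → Set where
    beta   : ∀ {L V W T} → L ⊢ app V (bind abst W T) ⟶[ 0 ] bind abbr (cast W V) T
    delta  : ∀ {K V} → (K , abbr [ V ]) ⊢ var 0 ⟶[ 0 ] ↑ V
    zeta   : ∀ {L V T} → L ⊢ bind abbr V (↑ T) ⟶[ 0 ] T          -- x not free in body
    theta  : ∀ {L V W T} → L ⊢ app V (bind abbr W T) ⟶[ 0 ] bind abbr W (app (↑ V) T)
    eps    : ∀ {L U T} → L ⊢ cast U T ⟶[ 0 ] T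
    sortS  : ∀ {L s} → L ⊢ sort s ⟶[ 1 ] sort (next s)
    ldelta : ∀ {K W} → (K , abst [ W ]) ⊢ var 0 ⟶[ 1 ] ↑ W
    ee     : ∀ {L U T} → L ⊢ cast U T ⟶[ 1 ] U
    lref   : ∀ {K b V i n T} → K ⊢ var i ⟶[ n ] T → (K , b [ V ]) ⊢ var (suc i) ⟶[ n ] ↑ T
    appL   : ∀ {L V₁ V₂ T} → L ⊢ V₁ ⟶[ 0 ] V₂ → L ⊢ app V₁ T ⟶[ 0 ] app V₂ T
    appR   : ∀ {L V T₁ T₂ n} → L ⊢ T₁ ⟶[ n ] T₂ → L ⊢ app V T₁ ⟶[ n ] app V T₂
    bindL  : ∀ {L b V₁ V₂ T} → L ⊢ V₁ ⟶[ 0 ] V₂ → L ⊢ bind b V₁ T ⟶[ 0 ] bind b V₂ T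
    bindR  : ∀ {L b V T₁ T₂ n} → (L , b [ V ]) ⊢ T₁ ⟶[ n ] T₂ → L ⊢ bind b V T₁ ⟶[ n ] bind b V T₂
    castL  : ∀ {L U₁ U₂ T} → L ⊢ U₁ ⟶[ 0 ] U₂ → L ⊢ cast U₁ T ⟶[ 0 ] cast U₂ T
    castR  : ∀ {L U T₁ T₂} → L ⊢ T₁ ⟶[ 0 ] T₂ → L ⊢ cast U T₁ ⟶[ 0 ] cast U T₂
    castLR : ∀ {L U₁ U₂ T₁ T₂} → L ⊢ U₁ ⟶[ 1 ] U₂ → L ⊢ T₁ ⟶[ 1 ] T₂ →
             L ⊢ cast U₁ T₁ ⟶[ 1 ] cast U₂ T₂

  data _⊢_⟶*[_]_ : Env S → Term S → ℕ → Term S → Set where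
    refl* : ∀ {L T} → L ⊢ T ⟶*[ 0 ] T
    step* : ∀ {L T₁ T₂ n} → L ⊢ T₁ ⟶[ n ] T₂ → L ⊢ T₁ ⟶*[ n ] T₂
    trans* : ∀ {L T₁ T T₂ n₁ n₂} → L ⊢ T₁ ⟶*[ n₁ ] T → L ⊢ T ⟶*[ n₂ ] T₂ →
             L ⊢ T₁ ⟶*[ n₁ + n₂ ] T₂

  data _⊢[_]_ : Env S → (ℕ → Set) → Term S → Set₁ where
    vSort : ∀ {L A s} → L ⊢[ A ] sort s
    vVar0 : ∀ {K A b V} → K ⊢[ A ] V → (K , b [ V ]) ⊢[ A ] var 0
    vVarS : ∀ {K A b V i} → K ⊢[ A ] var i → (K , b [ V ]) ⊢[ A ] var (suc i)
    vBind : ∀ {L A b V T} → L ⊢[ A ] V → (L , b [ V ]) ⊢[ A ] T → L ⊢[ A ] bind b V T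
    vCast : ∀ {L A U T} → L ⊢[ A ] U → L ⊢[ A ] T →
            (∃[ U₀ ] (L ⊢ T ⟶*[ 1 ] U₀ × L ⊢ U ⟶*[ 0 ] U₀)) → L ⊢[ A ] cast U T
    vApp  : ∀ {L A V T} → L ⊢[ A ] V → L ⊢[ A ] T →
            (∃[ n ] ∃[ W₀ ] ∃[ U₀ ] (A n × L ⊢ T ⟶*[ n ] bind abst W₀ U₀ × L ⊢ V ⟶*[ 1 ] W₀)) →
            L ⊢[ A ] app V T

module Submission where

-- Every rule except vApp carries over
-- verbatim.  For vApp we have L ⊢ T ⟶*[m] λW₀.U₀ with m ∈ A₁ and must
-- produce L ⊢ T ⟶*[n] λW₀.U' for some n ∈ A₂ with m ≤ n, keeping W₀.
-- This is done by performing n ∸ m further weight-1 steps inside the body.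
--
-- Such steps exist because every WELL-SCOPED term (all its variables point
-- into the environment, and so do those of the environment entries) has a
-- reduct of weight exactly 1: sorts step to the next sort, casts to their
-- type, λ-variables to their declared type, and def-variables unfold (weight
-- 0) to a term of smaller "scoped size", so unfolding terminates.

open import Defs
open import Data.Nat using (ℕ; zero; suc; _+_; _∸_; _≤_; _<_; _<ᵇ_; s≤s)
open import Data.Nat.Properties using (m≤n+m; ≤-refl; ≤-trans; <-trans; ≤-pred; m+[n∸m]≡n)
open import Data.Bool using (true; false; if_then_else_)
open import Data.Product using (∃-syntax; _×_; _,_)
open import Data.Sum using (_⊎_; inj₁; inj₂)
open import Relation.Binary.Definitions using (DecidableEquality)
open import Relation.Binary.PropositionalEquality using (_≡_; refl; subst)

module _ {S : Set} where

  -- A def-unfolding strictly lowers s.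
  data Scoped : Env S → Term S → ℕ → Set where
    sc-sort : ∀ {L s} → Scoped L (sort s) 0
    sc-var0 : ∀ {K b V s} → Scoped K V s → Scoped (K , b [ V ]) (var 0) (suc s)
    sc-varS : ∀ {K b V i s} → Scoped K (var i) s → Scoped (K , b [ V ]) (var (suc i)) s
    sc-app  : ∀ {L V T s₁ s₂} → Scoped L V s₁ → Scoped L T s₂ →
              Scoped L (app V T) (suc (s₁ + s₂))
    sc-bind : ∀ {L b V T s₁ s₂} → Scoped L V s₁ → Scoped (L , b [ V ]) T s₂ →
              Scoped L (bind b V T) (suc (s₁ + s₂))
    sc-cast : ∀ {L U T s₁ s₂} → Scoped L U s₁ → Scoped L T s₂ →
              Scoped L (cast U T) (suc (s₁ + s₂))

  IsScoped : Env S → Term S → Set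
  IsScoped L T = ∃[ s ] Scoped L T s

  is-var0 : ∀ {K b V} → IsScoped K V → IsScoped (K , b [ V ]) (var 0)
  is-var0 (_ , v) = _ , sc-var0 v

  is-varS : ∀ {K b V i} → IsScoped K (var i) → IsScoped (K , b [ V ]) (var (suc i))
  is-varS (_ , x) = _ , sc-varS x

  is-app : ∀ {L V T} → IsScoped L V → IsScoped L T → IsScoped L (app V T)
  is-app (_ , v) (_ , t) = _ , sc-app v t

  is-bind : ∀ {L b V T} → IsScoped L V → IsScoped (L , b [ V ]) T → IsScoped L (bind b V T)
  is-bind (_ , v) (_ , t) = _ , sc-bind v t

  is-cast : ∀ {L U T} → IsScoped L U → IsScoped L T → IsScoped L (cast U T)
  is-cast (_ , u) (_ , t) = _ , sc-cast u t

  data Insert (b : BKind) (X : Term S) : ℕ → Env S → Env S → Set where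
    at-top : ∀ {L} → Insert b X 0 L (L , b [ X ])
    under  : ∀ {d L L' c V} → Insert b X d L L' →
             Insert b X (suc d) (L , c [ V ]) (L' , c [ lift d V ])

  lift-scoped : ∀ {b X d L L' T s} → Insert b X d L L' → Scoped L T s → Scoped L' (lift d T) s
  lift-scoped ins sc-sort = sc-sort
  lift-scoped at-top (sc-var0 v) = sc-varS (sc-var0 v)
  lift-scoped (under ins) (sc-var0 v) = sc-var0 (lift-scoped ins v)
  lift-scoped at-top (sc-varS x) = sc-varS (sc-varS x)
  -- lift (suc d) (var (suc i)) is the successor of lift d (var i), by cases on i < d
  lift-scoped (under {d = d} ins) (sc-varS {i = i} x) with i <ᵇ d | lift-scoped ins x
  ... | true  | x′ = sc-varS x′
  ... | false | x′ = sc-varS x′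
  lift-scoped ins (sc-app v t) = sc-app (lift-scoped ins v) (lift-scoped ins t)
  lift-scoped ins (sc-bind v t) = sc-bind (lift-scoped ins v) (lift-scoped (under ins) t)
  lift-scoped ins (sc-cast u t) = sc-cast (lift-scoped ins u) (lift-scoped ins t)

  -- Conversely a lifted term scoped in the enlarged environment is scoped in
  -- the original one (needed for ζ-reduction, which drops a vacuous def).
  unlift-scoped : ∀ {b X d L L' s} T → Insert b X d L L' → Scoped L' (lift d T) s → Scoped L T s

  unlift-var-scoped : ∀ {b X d L L' s} i c → (i <ᵇ d) ≡ c → Insert b X d L L' →
                      Scoped L' (if c then var i else var (suc i)) s → Scoped L (var i) s
  unlift-var-scoped i false _ at-top (sc-varS x) = x
  unlift-var-scoped zero true _ (under {V = V} ins) (sc-var0 v) = sc-var0 (unlift-scoped V ins v)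
  unlift-var-scoped (suc i) true i<d (under ins) (sc-varS x) =
    sc-varS (unlift-var-scoped i true i<d ins x)
  unlift-var-scoped (suc i) false i≮d (under ins) (sc-varS x) =
    sc-varS (unlift-var-scoped i false i≮d ins x)

  unlift-scoped (sort _) ins sc-sort = sc-sort
  unlift-scoped {d = d} (var i) ins x = unlift-var-scoped i (i <ᵇ d) refl ins x
  unlift-scoped (app V T) ins (sc-app v t) = sc-app (unlift-scoped V ins v) (unlift-scoped T ins t)
  unlift-scoped (bind b V T) ins (sc-bind v t) =
    sc-bind (unlift-scoped V ins v) (unlift-scoped T (under ins) t)
  unlift-scoped (cast U T) ins (sc-cast u t) = sc-cast (unlift-scoped U ins u) (unlift-scoped T ins t)

  data EnvUpdate : Env S → Env S → Set where
    upd-∅   : EnvUpdate ∅ ∅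
    keep    : ∀ {K K' b b' V} → EnvUpdate K K' → EnvUpdate (K , b [ V ]) (K' , b' [ V ])
    replace : ∀ {K K' b b' V V'} → EnvUpdate K K' → IsScoped K' V' →
              EnvUpdate (K , b [ V ]) (K' , b' [ V' ])

  update-refl : ∀ L → EnvUpdate L L
  update-refl ∅ = upd-∅
  update-refl (L , b [ V ]) = keep (update-refl L)

  update-scoped : ∀ {L L' T s} → EnvUpdate L L' → Scoped L T s → IsScoped L' T
  update-scoped e sc-sort = _ , sc-sort
  update-scoped (keep e) (sc-var0 v) = is-var0 (update-scoped e v)
  update-scoped (replace e v′) (sc-var0 _) = is-var0 v′
  update-scoped (keep e) (sc-varS x) = is-varS (update-scoped e x)
  update-scoped (replace e _) (sc-varS x) = is-varS (update-scoped e x)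
  update-scoped e (sc-app v t) = is-app (update-scoped e v) (update-scoped e t)
  update-scoped e (sc-bind v t) = is-bind (update-scoped e v) (update-scoped (keep e) t)
  update-scoped e (sc-cast u t) = is-cast (update-scoped e u) (update-scoped e t)

  replace-top : ∀ {L b b' V V' T s} → IsScoped L V' → Scoped (L , b [ V ]) T s →
                IsScoped (L , b' [ V' ]) T
  replace-top {L} v′ = update-scoped (replace (update-refl L) v′)

module _ {S : Set} (next : S → S) where

  _⊢_↦[_]_ : Env S → Term S → ℕ → Term S → Set
  L ⊢ T₁ ↦[ n ] T₂ = _⊢_⟶[_]_ next L T₁ n T₂

  _⊢_↦*[_]_ : Env S → Term S → ℕ → Term S → Set
  L ⊢ T₁ ↦*[ n ] T₂ = _⊢_⟶*[_]_ next L T₁ n T₂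

  step-scoped : ∀ {L T₁ T₂ n} → IsScoped L T₁ → L ⊢ T₁ ↦[ n ] T₂ → IsScoped L T₂
  step-scoped (_ , sc-app v (sc-bind w t)) beta = is-bind wv (replace-top wv t)
    where wv = is-cast (_ , w) (_ , v)
  step-scoped (_ , sc-var0 v) delta = _ , lift-scoped at-top v
  step-scoped (_ , sc-bind _ t) zeta = _ , unlift-scoped _ at-top t
  step-scoped (_ , sc-app v (sc-bind w t)) theta = _ , sc-bind w (sc-app (lift-scoped at-top v) t)
  step-scoped (_ , sc-cast _ t) eps = _ , t
  step-scoped (_ , sc-sort) sortS = _ , sc-sort
  step-scoped (_ , sc-var0 w) ldelta = _ , lift-scoped at-top w
  step-scoped (_ , sc-cast u _) ee = _ , u
  step-scoped (_ , sc-varS x) (lref r) with step-scoped (_ , x) r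
  ... | _ , t = _ , lift-scoped at-top t
  step-scoped (_ , sc-app v t) (appL r) = is-app (step-scoped (_ , v) r) (_ , t)
  step-scoped (_ , sc-app v t) (appR r) = is-app (_ , v) (step-scoped (_ , t) r)
  step-scoped (_ , sc-bind v t) (bindL r) = is-bind v′ (replace-top v′ t)
    where v′ = step-scoped (_ , v) r
  step-scoped (_ , sc-bind v t) (bindR r) = is-bind (_ , v) (step-scoped (_ , t) r)
  step-scoped (_ , sc-cast u t) (castL r) = is-cast (step-scoped (_ , u) r) (_ , t)
  step-scoped (_ , sc-cast u t) (castR r) = is-cast (_ , u) (step-scoped (_ , t) r)
  step-scoped (_ , sc-cast u t) (castLR r r′) = is-cast (step-scoped (_ , u) r) (step-scoped (_ , t) r′)

  steps-scoped : ∀ {L T₁ T₂ n} → IsScoped L T₁ → L ⊢ T₁ ↦*[ n ] T₂ → IsScoped L T₂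
  steps-scoped t refl* = t
  steps-scoped t (step* r) = step-scoped t r
  steps-scoped t (trans* r r′) = steps-scoped (steps-scoped t r) r′

  valid-scoped : ∀ {L A T} → _⊢[_]_ next L A T → IsScoped L T
  valid-scoped vSort = _ , sc-sort
  valid-scoped (vVar0 v) = is-var0 (valid-scoped v)
  valid-scoped (vVarS x) = is-varS (valid-scoped x)
  valid-scoped (vBind v t) = is-bind (valid-scoped v) (valid-scoped t)
  valid-scoped (vCast u t _) = is-cast (valid-scoped u) (valid-scoped t)
  valid-scoped (vApp v t _) = is-app (valid-scoped v) (valid-scoped t)

  app-steps : ∀ {L V T₁ T₂ n} → L ⊢ T₁ ↦*[ n ] T₂ → L ⊢ app V T₁ ↦*[ n ] app V T₂
  app-steps refl* = refl*
  app-steps (step* r) = step* (appR r)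
  app-steps (trans* r r′) = trans* (app-steps r) (app-steps r′)

  bind-steps : ∀ {L b V T₁ T₂ n} → (L , b [ V ]) ⊢ T₁ ↦*[ n ] T₂ → L ⊢ bind b V T₁ ↦*[ n ] bind b V T₂
  bind-steps refl* = refl*
  bind-steps (step* r) = step* (bindR r)
  bind-steps (trans* r r′) = trans* (bind-steps r) (bind-steps r′)

  var-step : ∀ {L i s} → Scoped L (var i) s →
    (∃[ T ] (L ⊢ var i ↦[ 1 ] T × IsScoped L T)) ⊎
    (∃[ T ] ∃[ s′ ] (L ⊢ var i ↦[ 0 ] T × Scoped L T s′ × s′ < s))
  var-step (sc-var0 {b = abst} w) = inj₁ (_ , ldelta , _ , lift-scoped at-top w)
  var-step (sc-var0 {b = abbr} v) = inj₂ (_ , _ , delta , lift-scoped at-top v , ≤-refl)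
  var-step (sc-varS x) with var-step x
  ... | inj₁ (_ , r , _ , t)         = inj₁ (_ , lref r , _ , lift-scoped at-top t)
  ... | inj₂ (_ , s′ , r , t , s′<s) = inj₂ (_ , s′ , lref r , lift-scoped at-top t , s′<s)

  -- Every well-scoped term has a well-scoped reduct of weight exactly 1;
  -- the bound f on the size makes the unfolding of definitions terminate.
  weight-one-bounded : ∀ f {L T s} → Scoped L T s → s < f → ∃[ T′ ] (L ⊢ T ↦*[ 1 ] T′ × IsScoped L T′)
  weight-one-bounded f sc-sort _ = _ , step* sortS , _ , sc-sort
  weight-one-bounded (suc f) {T = var _} x s<f with var-step x
  ... | inj₁ (T , r , t) = T , step* r , t
  ... | inj₂ (_ , _ , r , t , s′<s) with weight-one-bounded f t (≤-trans s′<s (≤-pred s<f))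
  ...   | T′ , r′ , t′ = T′ , trans* (step* r) r′ , t′
  weight-one-bounded f (sc-app v t) s<f with weight-one-bounded f t (<-trans (s≤s (m≤n+m _ _)) s<f)
  ... | T′ , r , t′ = _ , app-steps r , is-app (_ , v) t′
  weight-one-bounded f (sc-bind v t) s<f with weight-one-bounded f t (<-trans (s≤s (m≤n+m _ _)) s<f)
  ... | T′ , r , t′ = _ , bind-steps r , is-bind (_ , v) t′
  weight-one-bounded f (sc-cast u _) _ = _ , step* ee , _ , u

  weight-one : ∀ {L T} → IsScoped L T → ∃[ T′ ] (L ⊢ T ↦*[ 1 ] T′ × IsScoped L T′)
  weight-one (s , t) = weight-one-bounded (suc s) t ≤-refl

  weight-k : ∀ k {L T} → IsScoped L T → ∃[ T′ ] L ⊢ T ↦*[ k ] T′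
  weight-k zero _ = _ , refl*
  weight-k (suc k) t with weight-one t
  ... | T′ , r , t′ with weight-k k t′
  ...   | T″ , r′ = T″ , trans* r r′

  pad-abstraction : ∀ {L T m n W U} → m ≤ n → IsScoped (L , abst [ W ]) U →
    L ⊢ T ↦*[ m ] bind abst W U → ∃[ U′ ] L ⊢ T ↦*[ n ] bind abst W U′
  pad-abstraction {L} {T} {m} {n} {W} m≤n u r with weight-k (n ∸ m) u
  ... | U′ , r′ = U′ , subst (λ k → L ⊢ T ↦*[ k ] bind abst W U′) (m+[n∸m]≡n m≤n) (trans* r (bind-steps r′))

  Dominates : (ℕ → Set) → (ℕ → Set) → Set
  Dominates A₂ A₁ = ∀ m → A₁ m → ∃[ n ] (A₂ n × m ≤ n)

  valid-mono : ∀ {A₁ A₂ L T} → Dominates A₂ A₁ → _⊢[_]_ next L A₁ T → _⊢[_]_ next L A₂ T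
  valid-mono dom vSort = vSort
  valid-mono dom (vVar0 v) = vVar0 (valid-mono dom v)
  valid-mono dom (vVarS x) = vVarS (valid-mono dom x)
  valid-mono dom (vBind v t) = vBind (valid-mono dom v) (valid-mono dom t)
  valid-mono dom (vCast u t conv) = vCast (valid-mono dom u) (valid-mono dom t) conv
  valid-mono dom (vApp v t (m , W₀ , U₀ , m∈A₁ , T↦λ , V↦W₀))
    with dom m m∈A₁ | steps-scoped (valid-scoped t) T↦λ
  ... | n , n∈A₂ , m≤n | _ , sc-bind _ u with pad-abstraction m≤n (_ , u) T↦λ
  ...   | U′ , T↦λ′ = vApp (valid-mono dom v) (valid-mono dom t) (n , W₀ , U′ , n∈A₂ , T↦λ′ , V↦W₀)

theorem5p5 : {S : Set} → DecidableEquality S → S → (next : S → S) →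
    (A₁ A₂ : ℕ → Set) → (∀ m → A₁ m → ∃[ n ] (A₂ n × m ≤ n)) →
    (L : Env S) (T : Term S) → _⊢[_]_ next L A₁ T → _⊢[_]_ next L A₂ T
theorem5p5 _ _ next _ _ dom _ _ = valid-mono next dom
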